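{- Let $q$ be a prime power, let $m\geq 3$ and $n$ be integers, let $V$ be an $n$-dimensional vector space over $\mathbb{F}_q$, and let $\mathscr{F}$ be an intersecting family of $m$-dimensional subspaces of $V$ with covering number $\tau(\mathscr{F})=m$. For a subspace $A$ of $V$ write $\mathscr{F}_A=\{F\in\mathscr{F}: A\subseteq F\}$. Let $s\leq t\leq m$ be nonnegative integers. Then for every $s$-dimensional subspace $S$ of $V$ there exists a $t$-dimensional subspace $T$ of $V$ such that $$|\mathscr{F}_S|\leq {m\brack 1}_q^{\,t-s}|\mathscr{F}_T|.$$ Moreover, $|\mathscr{F}_S|\leq {m\brack 1}_q^{\,m-s}$ for every $s$-dimensional subspace $S$ of $V$ with $s\le m$.
   Context: ${m\brack 1}_q=\frac{q^m-1}{q-1}$. Two subspaces $A,B$ intersect if $\dim(A\cap B)\geq 1$; a family is intersecting if any two members intersect. The covering number $\tau(\mathscr{F})$ is the minimum dimension of a subspace of $V$ intersecting every member of $\mathscr{F}$. -}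

module Defs where

open import Level using (0ℓ)
open import Algebra.Bundles using (CommutativeRing)
open import Data.Nat using (ℕ; zero; suc; _≤_)
import Data.Nat as N
open import Data.Nat.Primality using (Prime)
open import Data.Fin using (Fin)
import Data.Fin as Fin
open import Data.Bool using (Bool; true; false; _∧_; _∨_; not; if_then_else_)
open import Data.List using (List; []; _∷_; length; map; concatMap)
open import Data.List.Relation.Unary.Any using (Any)
open import Data.List.Relation.Unary.AllPairs using (AllPairs)
open import Data.Product using (Σ; ∃; ∃-syntax; _×_; _,_)
open import Data.Vec.Functional using () renaming (_∷_ to _∷ᶠ_)
open import Relation.Binary.PropositionalEquality using (_≡_; refl)
open import Relation.Binary using (Decidable)
open import Relation.Nullary using (¬_)
open import Function.Bundles using (_⇔_)

IsPrimePower : ℕ → Set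
IsPrimePower q = Σ ℕ λ p → Σ ℕ λ k → Prime p × q ≡ p N.^ suc k

record FiniteField (q : ℕ) : Set₁ where
  field
    cring     : CommutativeRing 0ℓ 0ℓ
  open CommutativeRing cring public
  field
    0≉1       : ¬ (0# ≈ 1#)
    inverse   : ∀ x → ¬ (x ≈ 0#) → ∃[ y ] (x * y ≈ 1#)
    _≟_       : Decidable _≈_
    elems     : List Carrier
    elems-len : length elems ≡ q
    complete  : ∀ x → Any (x ≈_) elems
    distinct  : AllPairs (λ a b → ¬ (a ≈ b)) elems

module VectorSpace {q : ℕ} (K : FiniteField q) (n : ℕ) where
  open FiniteField K using (Carrier; _≈_; _+_; _*_; 0#; elems)

  V : Set
  V = Fin n → Carrier

  _≈ᵥ_ : V → V → Set
  u ≈ᵥ v = ∀ i → u i ≈ v i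

  0ᵥ : V
  0ᵥ _ = 0#

  _+ᵥ_ : V → V → V
  (u +ᵥ v) i = u i + v i

  _·ᵥ_ : Carrier → V → V
  (a ·ᵥ v) i = a * v i

  allVecs : (m : ℕ) → List (Fin m → Carrier)
  allVecs zero    = (λ ()) ∷ []
  allVecs (suc m) = concatMap (λ a → map (λ v → a ∷ᶠ v) (allVecs m)) elems

  record Subspace : Set where
    field
      mem      : V → Bool
      resp     : ∀ {u v} → u ≈ᵥ v → mem u ≡ mem v
      has-0    : mem 0ᵥ ≡ true
      closed-+ : ∀ {u v} → mem u ≡ true → mem v ≡ true → mem (u +ᵥ v) ≡ true
      closed-· : ∀ a {v} → mem v ≡ true → mem (a ·ᵥ v) ≡ true
  open Subspace public

  lin : {d : ℕ} → (Fin d → Carrier) → (Fin d → V) → V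
  lin {zero}  c b = 0ᵥ
  lin {suc d} c b = (c Fin.zero ·ᵥ b Fin.zero) +ᵥ lin (λ i → c (Fin.suc i)) (λ i → b (Fin.suc i))

  LinIndep : {d : ℕ} → (Fin d → V) → Set
  LinIndep {d} b = ∀ (c : Fin d → Carrier) → lin c b ≈ᵥ 0ᵥ → ∀ i → c i ≈ 0#

  HasDim : Subspace → ℕ → Set
  HasDim A d = Σ (Fin d → V) λ b → LinIndep b ×
               (∀ v → (mem A v ≡ true) ⇔ (∃[ c ] (v ≈ᵥ lin c b)))

  _∩_ : Subspace → Subspace → Subspace
  A ∩ B = record
    { mem = λ v → mem A v ∧ mem B v
    ; resp = λ {u} {v} e → cong∧ (resp A e) (resp B e)
    ; has-0 = t∧t (has-0 A) (has-0 B)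
    ; closed-+ = λ p r → t∧t (closed-+ A (∧₁ p) (∧₁ r)) (closed-+ B (∧₂ p) (∧₂ r))
    ; closed-· = λ a p → t∧t (closed-· A a (∧₁ p)) (closed-· B a (∧₂ p))
    }
    where
    cong∧ : ∀ {a b c d} → a ≡ b → c ≡ d → (a ∧ c) ≡ (b ∧ d)
    cong∧ refl refl = refl
    t∧t : ∀ {a b} → a ≡ true → b ≡ true → (a ∧ b) ≡ true
    t∧t refl refl = refl
    ∧₁ : ∀ {a b} → (a ∧ b) ≡ true → a ≡ true
    ∧₁ {true} _ = refl
    ∧₁ {false} ()
    ∧₂ : ∀ {a b} → (a ∧ b) ≡ true → b ≡ true
    ∧₂ {true} p = p
    ∧₂ {false} ()

  Intersect : Subspace → Subspace → Set
  Intersect A B = ∃[ d ] (1 ≤ d × HasDim (A ∩ B) d)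

  allᵇ : {X : Set} → (X → Bool) → List X → Bool
  allᵇ p []       = true
  allᵇ p (x ∷ xs) = p x ∧ allᵇ p xs

  _⊆ᵇ_ : Subspace → Subspace → Bool
  A ⊆ᵇ B = allᵇ (λ v → not (mem A v) ∨ mem B v) (allVecs n)

  Distinct : Subspace → Subspace → Set
  Distinct A B = ¬ (∀ v → mem A v ≡ mem B v)

  Family : Set
  Family = List Subspace

  IsFamily : Family → Set
  IsFamily 𝓕 = AllPairs Distinct 𝓕

  AllDim : Family → ℕ → Set
  AllDim 𝓕 m = ∀ {F} → Data.List.Membership.Propositional._∈_ F 𝓕 → HasDim F m
    where import Data.List.Membership.Propositional

  IsIntersecting : Family → Set
  IsIntersecting 𝓕 = AllPairs Intersect 𝓕

  Covers : Subspace → Family → Set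
  Covers T 𝓕 = ∀ {F} → Data.List.Membership.Propositional._∈_ F 𝓕 → Intersect T F
    where import Data.List.Membership.Propositional

  CoveringNumber : Family → ℕ → Set
  CoveringNumber 𝓕 k =
    (∃[ T ] (HasDim T k × Covers T 𝓕)) ×
    (∀ T d → HasDim T d → Covers T 𝓕 → k ≤ d)

  countSup : Subspace → Family → ℕ
  countSup A []      = 0
  countSup A (F ∷ 𝓕) = (if A ⊆ᵇ F then 1 else 0) N.+ countSup A 𝓕

-- Gaussian binomial [m 1]_q = (q^m - 1)/(q - 1) = 1 + q + ... + q^(m-1)
gauss1 : ℕ → ℕ → ℕ
gauss1 q zero    = 0
gauss1 q (suc m) = q N.^ m N.+ gauss1 q m

-- If dim S = s < m = τ(𝓕), then S is not a cover, so S ∩ F = 0 for some F ∈ 𝓕. Every member G ⊇ S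
-- meets F in a nonzero x and hence contains the (s+1)-space S + ⟨x⟩; letting ⟨x⟩ run over the
-- [m 1]_q points of F gives |𝓕_S| ≤ Σ_x |𝓕_{S+⟨x⟩}| ≤ [m 1]_q · max_x |𝓕_{S+⟨x⟩}|. Iterating t − s times
-- proves the first claim, and for t = m the second follows because an m-space lies in at most one
-- member. Dimensions are compared by counting: k independent vectors in a d-space have q^k distinct
-- linear combinations among its q^d vectors, so k ≤ d.
module Submission where

open import Defs
import Algebra.Properties.CommutativeSemigroup as CommutativeSemigroupProperties
import Algebra.Properties.Group as GroupProperties
import Algebra.Properties.Ring as RingProperties
open import Data.Bool using (Bool; true; false; _∧_; not; _∨_; if_then_else_) renaming (_≟_ to _≟ᵇ_)
open import Data.Bool.Properties using (∧-conicalˡ; ∧-conicalʳ)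
open import Data.Empty using (⊥-elim)
open import Data.Fin using (Fin; zero; suc)
import Data.Fin.Properties as Fin
open import Data.List using (List; []; _∷_; _++_; length; map; concatMap)
open import Data.List.Properties using (length-map; length-++; length-removeAt′)
open import Data.List.Membership.Propositional using (find) renaming (_∈_ to _∈ₚ_)
open import Data.List.Relation.Unary.All as All using (All; []; _∷_)
import Data.List.Relation.Unary.All.Properties as All
open import Data.List.Relation.Unary.AllPairs as AllPairs using (AllPairs; []; _∷_)
import Data.List.Relation.Unary.AllPairs.Properties as AllPairs
open import Data.List.Relation.Unary.Any as Any using (Any; here; there; _─_)
import Data.List.Relation.Unary.Any.Properties as Any
open import Data.Nat using (ℕ; zero; suc; _+_; _*_; _^_; _∸_; _≤_; _<_; z≤n; s≤s; >-nonZero)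
open import Data.Nat.ListAction using (sum)
open import Data.Nat.Properties
  using ( ≤-refl; ≤-reflexive; ≤-trans; <⇒≤; <⇒≱; ≰⇒>; ≮⇒≥; _≤?_; +-suc; m≤m+n; m≤n+m
        ; +-mono-≤; +-monoʳ-≤; *-monoʳ-≤; m∸n+n≡m; ^-monoʳ-<; m^n>0; module ≤-Reasoning )
import Data.Nat.Properties as ℕ
open import Data.Product using (∃-syntax; _×_; _,_; proj₁; proj₂)
open import Data.Sum using (_⊎_; inj₁; inj₂)
open import Data.Vec.Functional using () renaming (_∷_ to _∷ᶠ_)
open import Function using (_∘_; _⇔_; mk⇔; Equivalence)
open import Relation.Binary using (Setoid)
open import Relation.Binary.PropositionalEquality as ≡ using (_≡_; refl; cong; subst)
open import Relation.Nullary using (¬_; Dec; yes; no; does; ¬?; _×-dec_)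
open import Relation.Nullary.Decidable using (dec-true; does-⇔; map′)

does≡true⇒ : ∀ {p} {P : Set p} (P? : Dec P) → does P? ≡ true → P
does≡true⇒ (yes p) _ = p

module _ {a ℓ} (S : Setoid a ℓ) where
  open Setoid S renaming (refl to ≈-refl; trans to ≈-trans; sym to ≈-sym)
  open import Data.List.Membership.Setoid S using (_∈_)
  open import Data.List.Relation.Binary.Subset.Setoid S using (_⊆_)
  open import Data.List.Relation.Unary.Unique.Setoid S using (Unique)

  ∈-─ : ∀ {x y ys} (x∈ys : x ∈ ys) → ¬ x ≈ y → y ∈ ys → y ∈ (ys ─ x∈ys)
  ∈-─ (here x≈z) x≉y (here y≈z)   = ⊥-elim (x≉y (≈-trans x≈z (≈-sym y≈z)))
  ∈-─ (here _)   _   (there y∈ys) = y∈ys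
  ∈-─ (there _)  _   (here y≈z)   = here y≈z
  ∈-─ (there x∈ys) x≉y (there y∈ys) = there (∈-─ x∈ys x≉y y∈ys)

  Unique∧⊆⇒length≤ : ∀ {xs ys} → Unique xs → xs ⊆ ys → length xs ≤ length ys
  Unique∧⊆⇒length≤ {[]} _ _ = z≤n
  Unique∧⊆⇒length≤ {x ∷ xs} {ys} (x≉xs ∷ xs!) x∷xs⊆ys =
    ≤-trans (s≤s (Unique∧⊆⇒length≤ xs! xs⊆ys─x)) (≤-reflexive (≡.sym (length-removeAt′ ys (Any.index x∈ys))))
    where
    x∈ys : x ∈ ys
    x∈ys = x∷xs⊆ys (here ≈-refl)
    xs⊆ys─x : xs ⊆ (ys ─ x∈ys)
    xs⊆ys─x {y} y∈xs with All.lookupAny x≉xs y∈xs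
    ... | x≉z , y≈z = ∈-─ x∈ys (λ x≈y → x≉z (≈-trans x≈y y≈z)) (x∷xs⊆ys (there y∈xs))

module _ {A : Set} where
  sum-map-+ : (f g : A → ℕ) (xs : List A) →
    sum (map (λ x → f x + g x) xs) ≡ sum (map f xs) + sum (map g xs)
  sum-map-+ f g [] = refl
  sum-map-+ f g (x ∷ xs) =
    ≡.trans (cong (f x + g x +_) (sum-map-+ f g xs)) (interchange (f x) (g x) _ _)
    where open CommutativeSemigroupProperties ℕ.+-commutativeSemigroup using (interchange)

  Any⇒≤sum : ∀ {k} (f : A → ℕ) {xs} → Any (λ x → k ≤ f x) xs → k ≤ sum (map f xs)
  Any⇒≤sum f (here k≤fx) = ≤-trans k≤fx (m≤m+n _ _)
  Any⇒≤sum f {x ∷ _} (there k≤fxs) = ≤-trans (Any⇒≤sum f k≤fxs) (m≤n+m _ (f x))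

  ∃-≥-mean : (f : A → ℕ) (xs : List A) → 0 < length xs →
    ∃[ x ] (x ∈ₚ xs × sum (map f xs) ≤ length xs * f x)
  ∃-≥-mean f (x ∷ []) _ = x , here refl , ≤-refl
  ∃-≥-mean f (x ∷ y ∷ ys) _ with ∃-≥-mean f (y ∷ ys) (s≤s z≤n)
  ... | z , z∈ , bound with f x ≤? f z
  ...   | yes fx≤fz = z , there z∈ , +-mono-≤ fx≤fz bound
  ...   | no fx≰fz  = x , here refl ,
            +-monoʳ-≤ (f x) (≤-trans bound (*-monoʳ-≤ (length (y ∷ ys)) (<⇒≤ (≰⇒> fx≰fz))))

  allPairs-∈ : ∀ {R : A → A → Set} {xs x y} → AllPairs R xs → x ∈ₚ xs → y ∈ₚ xs →
    x ≡ y ⊎ R x y ⊎ R y x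
  allPairs-∈ (_ ∷ _)    (here refl) (here refl) = inj₁ refl
  allPairs-∈ (Rx ∷ _)   (here refl) (there y∈) = inj₂ (inj₁ (All.lookup Rx y∈))
  allPairs-∈ (Rx ∷ _)   (there x∈)  (here refl) = inj₂ (inj₂ (All.lookup Rx x∈))
  allPairs-∈ (_ ∷ Rxs)  (there x∈)  (there y∈) = allPairs-∈ Rxs x∈ y∈

  length-concatMap : ∀ {B : Set} (f : A → List B) {k} → (∀ x → length (f x) ≡ k) →
    ∀ xs → length (concatMap f xs) ≡ length xs * k
  length-concatMap f |fx|≡k [] = refl
  length-concatMap f |fx|≡k (x ∷ xs) =
    ≡.trans (length-++ (f x)) (≡.cong₂ _+_ (|fx|≡k x) (length-concatMap f |fx|≡k xs))

gauss1-pos : ∀ {q} m → 0 < q → 0 < m → 0 < gauss1 q m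
gauss1-pos {q} (suc m) q>0 _ =
  ≤-trans (m^n>0 q {{>-nonZero q>0}} m) (m≤m+n (q ^ m) (gauss1 q m))

module LinearAlgebra {q : ℕ} (K : FiniteField q) (n : ℕ) where
  open VectorSpace K n
  open FiniteField K hiding (zero)
    renaming (refl to ≈-refl; sym to ≈-sym; trans to ≈-trans; _≟_ to _≈?_; _+_ to _⊕_; _*_ to _·_)
  open import Data.Vec.Functional.Relation.Binary.Equality.Setoid setoid
    using (_≋_; ≋-sym; ≋-trans; ≋-setoid)
  open GroupProperties +-group using (x∙y⁻¹≈ε⇒x≈y; inverseˡ-unique; ε⁻¹≈ε; ⁻¹-anti-homo-∙)
  open RingProperties ring using (-‿distribˡ-*; -‿distribʳ-*)

  _∈ˢ_ : V → Subspace → Set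
  v ∈ˢ A = mem A v ≡ true

  _⊆ˢ_ : Subspace → Subspace → Set
  A ⊆ˢ B = ∀ {v} → v ∈ˢ A → v ∈ˢ B

  Disjoint : Subspace → Subspace → Set
  Disjoint A B = ∀ {v} → v ∈ˢ A → v ∈ˢ B → v ≋ 0ᵥ

  _≋?_ : ∀ {d} (u v : Fin d → Carrier) → Dec (u ≋ v)
  u ≋? v = Fin.all? (λ i → u i ≈? v i)

  2≤q : 2 ≤ q
  2≤q = subst (2 ≤_) elems-len
    (Unique∧⊆⇒length≤ setoid ((0≉1 ∷ []) ∷ [] ∷ []) (λ {x} _ → complete x))

  allVecs-complete : ∀ {d} (c : Fin d → Carrier) → Any (c ≋_) (allVecs d)
  allVecs-complete {zero}  c = here (λ ())
  allVecs-complete {suc d} c = Any.concatMap⁺ _ (Any.map cons (complete (c zero)))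
    where
    cons : ∀ {a} → c zero ≈ a → Any (c ≋_) (map (a ∷ᶠ_) (allVecs d))
    cons c₀≈a = Any.map⁺ (Any.map (λ { c₊≋v zero → c₀≈a ; c₊≋v (suc i) → c₊≋v i })
                                  (allVecs-complete (c ∘ suc)))

  allVecs-unique : ∀ d → AllPairs (λ c c' → ¬ c ≋ c') (allVecs d)
  allVecs-unique zero    = [] ∷ []
  allVecs-unique (suc d) = AllPairs.concat⁺
    (All.map⁺ (All.universal
      (λ a → AllPairs.map⁺ (AllPairs.map (λ u≉v e → u≉v (e ∘ suc)) (allVecs-unique d))) elems))
    (AllPairs.map⁺ (AllPairs.map heads-differ distinct))
    where
    heads-differ : ∀ {a b} → ¬ a ≈ b →
      All (λ u → All (λ v → ¬ u ≋ v) (map (b ∷ᶠ_) (allVecs d))) (map (a ∷ᶠ_) (allVecs d))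
    heads-differ a≉b =
      All.map⁺ (All.universal (λ _ → All.map⁺ (All.universal (λ _ e → a≉b (e zero)) _)) _)

  length-allVecs : ∀ d → length (allVecs d) ≡ q ^ d
  length-allVecs zero    = refl
  length-allVecs (suc d) =
    ≡.trans (length-concatMap _ (λ a → ≡.trans (length-map _ (allVecs d)) (length-allVecs d)) elems)
            (cong (_* q ^ d) elems-len)

  lin-cong : ∀ {d} {c c' : Fin d → Carrier} (b : Fin d → V) → c ≋ c' → lin c b ≋ lin c' b
  lin-cong {zero}  b c≋c' j = ≈-refl
  lin-cong {suc d} b c≋c' j = +-cong (*-congʳ (c≋c' zero)) (lin-cong (b ∘ suc) (c≋c' ∘ suc) j)

  lin-zero : ∀ {d} (b : Fin d → V) → lin (λ _ → 0#) b ≋ 0ᵥ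
  lin-zero {zero}  b j = ≈-refl
  lin-zero {suc d} b j = ≈-trans (+-cong (zeroˡ _) (lin-zero (b ∘ suc) j)) (+-identityˡ 0#)

  lin-+ : ∀ {d} (c c' : Fin d → Carrier) (b : Fin d → V) →
    lin (λ i → c i ⊕ c' i) b ≋ (lin c b +ᵥ lin c' b)
  lin-+ {zero}  c c' b j = ≈-sym (+-identityˡ 0#)
  lin-+ {suc d} c c' b j = ≈-trans
    (+-cong (distribʳ _ _ _) (lin-+ (c ∘ suc) (c' ∘ suc) (b ∘ suc) j))
    (interchange _ _ _ _)
    where open CommutativeSemigroupProperties +-commutativeSemigroup using (interchange)

  lin-· : ∀ {d} (a : Carrier) (c : Fin d → Carrier) (b : Fin d → V) →
    lin (λ i → a · c i) b ≋ (a ·ᵥ lin c b)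
  lin-· {zero}  a c b j = ≈-sym (zeroʳ a)
  lin-· {suc d} a c b j = ≈-trans
    (+-cong (*-assoc _ _ _) (lin-· a (c ∘ suc) (b ∘ suc) j))
    (≈-sym (distribˡ _ _ _))

  lin-neg : ∀ {d} (c : Fin d → Carrier) (b : Fin d → V) → lin (λ i → - c i) b ≋ (λ j → - lin c b j)
  lin-neg {zero}  c b j = ≈-sym ε⁻¹≈ε
  lin-neg {suc d} c b j = ≈-trans
    (+-cong (≈-sym (-‿distribˡ-* _ _)) (lin-neg (c ∘ suc) (b ∘ suc) j))
    (≈-trans (+-comm _ _) (≈-sym (⁻¹-anti-homo-∙ _ _)))

  lin-injective : ∀ {d} {b : Fin d → V} → LinIndep b → ∀ {c c'} → lin c b ≋ lin c' b → c ≋ c'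
  lin-injective {b = b} ind {c} {c'} same i =
    x∙y⁻¹≈ε⇒x≈y _ _ (ind (λ i → c i ⊕ - c' i) difference≋0 i)
    where
    difference≋0 : lin (λ i → c i ⊕ - c' i) b ≋ 0ᵥ
    difference≋0 j = ≈-trans (lin-+ c (λ i → - c' i) b j)
      (≈-trans (+-cong (same j) (lin-neg c' b j)) (-‿inverseʳ _))

  unit : ∀ {d} → Fin d → Fin d → Carrier
  unit zero    = 1# ∷ᶠ (λ _ → 0#)
  unit (suc i) = 0# ∷ᶠ unit i

  lin-unit : ∀ {d} (b : Fin d → V) i → lin (unit i) b ≋ b i
  lin-unit b zero    j = ≈-trans (+-cong (*-identityˡ _) (lin-zero (b ∘ suc) j)) (+-identityʳ _)
  lin-unit b (suc i) j = ≈-trans (+-cong (zeroˡ _) (lin-unit (b ∘ suc) i j)) (+-identityˡ _)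

  lin-∈ : ∀ {d} (A : Subspace) (c : Fin d → Carrier) {b : Fin d → V} →
    (∀ i → b i ∈ˢ A) → lin c b ∈ˢ A
  lin-∈ {zero}  A c b∈A = has-0 A
  lin-∈ {suc d} A c b∈A = closed-+ A (closed-· A (c zero) (b∈A zero)) (lin-∈ A (c ∘ suc) (b∈A ∘ suc))

  InSpan : ∀ {d} → (Fin d → V) → V → Set
  InSpan b v = ∃[ c ] (v ≋ lin c b)

  InSpan-resp : ∀ {d} {b : Fin d → V} {u v} → u ≋ v → InSpan b v → InSpan b u
  InSpan-resp u≋v (c , v≋) = c , ≋-trans u≋v v≋

  inSpan? : ∀ {d} (b : Fin d → V) v → Dec (InSpan b v)
  inSpan? {d} b v = map′ Any.satisfied
    (λ (c , v≋) → Any.map (λ c≋c' → ≋-trans v≋ (lin-cong b c≋c')) (allVecs-complete c))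
    (Any.any? (λ c → v ≋? lin c b) (allVecs d))

  span : ∀ {d} → (Fin d → V) → Subspace
  span b = record
    { mem      = λ v → does (inSpan? b v)
    ; resp     = λ {u} {v} u≋v → does-⇔ (mk⇔ (InSpan-resp {b = b} (≋-sym u≋v)) (InSpan-resp u≋v))
                                          (inSpan? b u) (inSpan? b v)
    ; has-0    = dec-true (inSpan? b 0ᵥ) ((λ _ → 0#) , ≋-sym (lin-zero b))
    ; closed-+ = λ {u} {v} u∈ v∈ → dec-true (inSpan? b (u +ᵥ v))
                   (sum-in-span (does≡true⇒ (inSpan? b u) u∈) (does≡true⇒ (inSpan? b v) v∈))
    ; closed-· = λ a {v} v∈ → dec-true (inSpan? b (a ·ᵥ v)) (scaled-in-span a (does≡true⇒ (inSpan? b v) v∈))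
    }
    where
    sum-in-span : ∀ {u v} → InSpan b u → InSpan b v → InSpan b (u +ᵥ v)
    sum-in-span (c , u≋) (c' , v≋) =
      (λ i → c i ⊕ c' i) , ≋-trans (λ j → +-cong (u≋ j) (v≋ j)) (≋-sym (lin-+ c c' b))
    scaled-in-span : ∀ a {v} → InSpan b v → InSpan b (a ·ᵥ v)
    scaled-in-span a (c , v≋) = (λ i → a · c i) , ≋-trans (λ j → *-congˡ (v≋ j)) (≋-sym (lin-· a c b))

  ∈span⇔InSpan : ∀ {d} (b : Fin d → V) {v} → v ∈ˢ span b ⇔ InSpan b v
  ∈span⇔InSpan b {v} = mk⇔ (does≡true⇒ (inSpan? b v)) (dec-true (inSpan? b v))

  span-dim : ∀ {d} {b : Fin d → V} → LinIndep b → HasDim (span b) d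
  span-dim {b = b} ind = b , ind , λ v → ∈span⇔InSpan b

  span-⊆ : ∀ {d} {b : Fin d → V} (A : Subspace) → (∀ i → b i ∈ˢ A) → span b ⊆ˢ A
  span-⊆ {b = b} A b∈A v∈ with Equivalence.to (∈span⇔InSpan b) v∈
  ... | c , v≋ = ≡.trans (resp A v≋) (lin-∈ A c b∈A)

  LinIndep-∷ : ∀ {d} {u : Fin d → V} {v} → LinIndep u → ¬ InSpan u v → LinIndep (v ∷ᶠ u)
  LinIndep-∷ {u = u} {v} ind v∉ c lin≋0 with c zero ≈? 0#
  ... | yes c₀≈0 = λ { zero → c₀≈0 ; (suc i) → ind (c ∘ suc) tail≋0 i }
    where
    tail≋0 : lin (c ∘ suc) u ≋ 0ᵥ
    tail≋0 j = ≈-trans (≈-sym (≈-trans (+-congʳ (≈-trans (*-congʳ c₀≈0) (zeroˡ (v j)))) (+-identityˡ _)))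
                       (lin≋0 j)
  ... | no c₀≉0 with inverse (c zero) c₀≉0
  ...   | y , c₀y≈1 = ⊥-elim (v∉ ((λ i → (- y) · c (suc i)) , v≋))
    where
    open import Relation.Binary.Reasoning.Setoid setoid
    v≋ : v ≋ lin (λ i → (- y) · c (suc i)) u
    v≋ j = begin
      v j                          ≈⟨ *-identityˡ (v j) ⟨
      1# · v j                     ≈⟨ *-congʳ (≈-trans (*-comm y (c zero)) c₀y≈1) ⟨
      (y · c zero) · v j           ≈⟨ *-assoc _ _ _ ⟩
      y · (c zero · v j)           ≈⟨ *-congˡ (inverseˡ-unique _ _ (lin≋0 j)) ⟩
      y · (- lin (c ∘ suc) u j)    ≈⟨ -‿distribʳ-* _ _ ⟨
      - (y · lin (c ∘ suc) u j)    ≈⟨ -‿distribˡ-* _ _ ⟩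
      (- y) · lin (c ∘ suc) u j    ≈⟨ lin-· (- y) (c ∘ suc) u j ⟨
      lin (λ i → (- y) · c (suc i)) u j ∎

  LinIndep⇒q^k≤length : ∀ {k} {u : Fin k → V} → LinIndep u → (ys : List V) →
    (∀ c → Any (lin c u ≋_) ys) → q ^ k ≤ length ys
  LinIndep⇒q^k≤length {k} {u} ind ys spanned = subst (_≤ length ys)
    (≡.trans (length-map _ (allVecs k)) (length-allVecs k))
    (Unique∧⊆⇒length≤ (≋-setoid n)
      (AllPairs.map⁺ (AllPairs.map (λ c≉c' same → c≉c' (lin-injective ind same)) (allVecs-unique k)))
      combinations⊆ys)
    where
    combinations⊆ys : ∀ {v} → Any (v ≋_) (map (λ c → lin c u) (allVecs k)) → Any (v ≋_) ys
    combinations⊆ys v∈ with Any.satisfied (Any.map⁻ v∈)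
    ... | c , v≋ = Any.map (≋-trans v≋) (spanned c)

  q^k≤q^l⇒k≤l : ∀ {k l} → q ^ k ≤ q ^ l → k ≤ l
  q^k≤q^l⇒k≤l q^k≤q^l = ≮⇒≥ (λ l<k → <⇒≱ (^-monoʳ-< q 2≤q l<k) q^k≤q^l)

  LinIndep⇒≤n : ∀ {k} {u : Fin k → V} → LinIndep u → k ≤ n
  LinIndep⇒≤n ind = q^k≤q^l⇒k≤l (subst (_ ≤_) (length-allVecs n)
    (LinIndep⇒q^k≤length ind (allVecs n) (λ c → allVecs-complete _)))

  LinIndep⇒≤dim : ∀ {k d} (A : Subspace) → HasDim A d → {u : Fin k → V} → LinIndep u →
    (∀ i → u i ∈ˢ A) → k ≤ d
  LinIndep⇒≤dim {k} {d} A (w , _ , A≡span) {u} ind u∈A =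
    q^k≤q^l⇒k≤l (subst (_ ≤_) (≡.trans (length-map _ (allVecs d)) (length-allVecs d))
      (LinIndep⇒q^k≤length ind _ in-A))
    where
    in-A : ∀ c → Any (lin c u ≋_) (map (λ c' → lin c' w) (allVecs d))
    in-A c with Equivalence.to (A≡span (lin c u)) (lin-∈ A c u∈A)
    ... | c' , ≋lin = Any.map⁺ (Any.map (λ c'≋ → ≋-trans ≋lin (lin-cong w c'≋)) (allVecs-complete c'))

  -- Greedy basis: adjoin members of A outside the current span; since LinIndep⇒≤n bounds k,
  -- the invariant n < k + fuel keeps the fuel from running out.
  module _ (A : Subspace) where
    private
      Extends : ∀ {k} → (Fin k → V) → V → Set
      Extends u w = w ∈ˢ A × ¬ InSpan u w

      extends? : ∀ {k} (u : Fin k → V) w → Dec (Extends u w)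
      extends? u w = (mem A w ≟ᵇ true) ×-dec ¬? (inSpan? u w)

      extend : ∀ fuel {k} (u : Fin k → V) → LinIndep u → (∀ i → u i ∈ˢ A) → n < k + fuel →
        ∃[ d ] HasDim A d
      extend zero {k} u ind _ n<k =
        ⊥-elim (<⇒≱ (≤-trans n<k (≤-reflexive (ℕ.+-identityʳ k))) (LinIndep⇒≤n ind))
      extend (suc fuel) {k} u ind u∈A n<k+fuel with Any.any? (extends? u) (allVecs n)
      ... | yes some-extends with Any.satisfied some-extends
      ...   | w , w∈A , w∉span = extend fuel (w ∷ᶠ u) (LinIndep-∷ ind w∉span)
                                   (λ { zero → w∈A ; (suc i) → u∈A i }) (subst (n <_) (+-suc k fuel) n<k+fuel)
      extend (suc fuel) {k} u ind u∈A _ | no none-extends =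
        k , u , ind , λ v → mk⇔ (spanned v) (λ (c , v≋) → ≡.trans (resp A v≋) (lin-∈ A c u∈A))
        where
        spanned : ∀ v → v ∈ˢ A → InSpan u v
        spanned v v∈A with inSpan? u v
        ... | yes v∈span = v∈span
        ... | no v∉span = ⊥-elim (none-extends (Any.map
                (λ v≋w → ≡.trans (≡.sym (resp A v≋w)) v∈A , v∉span ∘ InSpan-resp v≋w)
                (allVecs-complete v)))

    hasDim : ∃[ d ] HasDim A d
    hasDim = extend (suc n) {0} (λ ()) (λ _ _ ()) (λ ()) (ℕ.n<1+n n)

  basis-∈ : ∀ {d} (A : Subspace) ((b , _) : HasDim A d) → ∀ i → b i ∈ˢ A
  basis-∈ A (b , _ , A≡span) i = Equivalence.from (A≡span (b i)) (unit i , ≋-sym (lin-unit b i))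

  basis-nonzero : ∀ {d} {b : Fin d → V} → LinIndep b → ∀ i → ¬ b i ≋ 0ᵥ
  basis-nonzero {b = b} ind i b≋0 =
    0≉1 (≈-sym (subst (_≈ 0#) (unit-diagonal i) (ind (unit i) (≋-trans (lin-unit b i) b≋0) i)))
    where
    unit-diagonal : ∀ {d} (i : Fin d) → unit i i ≡ 1#
    unit-diagonal zero    = refl
    unit-diagonal (suc i) = unit-diagonal i

  nonzero-member : ∀ {d} (A : Subspace) → 0 < d → HasDim A d → ∃[ x ] (x ∈ˢ A × ¬ x ≋ 0ᵥ)
  nonzero-member A (s≤s z≤n) hA@(b , ind , _) =
    b zero , basis-∈ A hA zero , basis-nonzero {b = b} ind zero

  ∈∩⇔ : ∀ A B {v} → v ∈ˢ (A ∩ B) ⇔ (v ∈ˢ A × v ∈ˢ B)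
  ∈∩⇔ A B = mk⇔ (λ v∈ → ∧-conicalˡ _ _ v∈ , ∧-conicalʳ _ _ v∈)
                 (λ (v∈A , v∈B) → ≡.cong₂ _∧_ v∈A v∈B)

  Intersect⇒nonzero : ∀ A B → Intersect A B → ∃[ x ] (x ∈ˢ A × x ∈ˢ B × ¬ x ≋ 0ᵥ)
  Intersect⇒nonzero A B (d , d>0 , h) with nonzero-member (A ∩ B) d>0 h
  ... | x , x∈A∩B , x≉0 with Equivalence.to (∈∩⇔ A B) x∈A∩B
  ...   | x∈A , x∈B = x , x∈A , x∈B , x≉0

  Intersect⊎Disjoint : ∀ A B → Intersect A B ⊎ Disjoint A B
  Intersect⊎Disjoint A B with hasDim (A ∩ B)
  ... | suc d , h            = inj₁ (suc d , s≤s z≤n , h)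
  ... | zero  , _ , _ , A∩B≡0 =
    inj₂ (λ v∈A v∈B → proj₂ (Equivalence.to (A∩B≡0 _) (Equivalence.from (∈∩⇔ A B) (v∈A , v∈B))))

  allᵇ⇒All : ∀ {X : Set} (p : X → Bool) xs → allᵇ p xs ≡ true → All (λ x → p x ≡ true) xs
  allᵇ⇒All p []       _    = []
  allᵇ⇒All p (x ∷ xs) p∧ps = ∧-conicalˡ _ _ p∧ps ∷ allᵇ⇒All p xs (∧-conicalʳ _ _ p∧ps)

  All⇒allᵇ : ∀ {X : Set} (p : X → Bool) {xs} → All (λ x → p x ≡ true) xs → allᵇ p xs ≡ true
  All⇒allᵇ p []            = refl
  All⇒allᵇ p (px ∷ pxs) rewrite px = All⇒allᵇ p pxs

  ⊆ᵇ⇒⊆ˢ : ∀ A B → A ⊆ᵇ B ≡ true → A ⊆ˢ B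
  ⊆ᵇ⇒⊆ˢ A B A⊆ᵇB {v} v∈A with All.lookupAny (allᵇ⇒All _ (allVecs n) A⊆ᵇB) (allVecs-complete v)
  ... | implies , v≋w = ≡.trans (resp B v≋w)
          (subst (λ a → not a ∨ mem B _ ≡ true) (≡.trans (≡.sym (resp A v≋w)) v∈A) implies)

  ⊆ˢ⇒⊆ᵇ : ∀ A B → A ⊆ˢ B → A ⊆ᵇ B ≡ true
  ⊆ˢ⇒⊆ᵇ A B A⊆B = All⇒allᵇ _ (All.universal implies (allVecs n))
    where
    implies : ∀ v → not (mem A v) ∨ mem B v ≡ true
    implies v with mem A v in v∈A
    ... | true  = A⊆B v∈A
    ... | false = refl

  ⊆ˢ-antisym : ∀ A B → A ⊆ˢ B → B ⊆ˢ A → ∀ v → mem A v ≡ mem B v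
  ⊆ˢ-antisym A B A⊆B B⊆A v with mem A v in v∈A | mem B v in v∈B
  ... | true  | true  = refl
  ... | false | false = refl
  ... | true  | false = ≡.trans (≡.sym (A⊆B v∈A)) v∈B
  ... | false | true  = ≡.trans (≡.sym v∈A) (B⊆A v∈B)

  ⊆∧≡dim⇒⊇ : ∀ {d} (T G : Subspace) → HasDim T d → HasDim G d → T ⊆ˢ G → G ⊆ˢ T
  ⊆∧≡dim⇒⊇ {d} T G hT@(b , ind , T≡span) hG T⊆G {v} v∈G with mem T v in v∈T
  ... | true  = refl
  ... | false = ⊥-elim (<⇒≱ (ℕ.n<1+n d) (LinIndep⇒≤dim G hG (LinIndep-∷ ind v∉span) v∷b∈G))
    where
    v∉span : ¬ InSpan b v
    v∉span v∈span with ≡.trans (≡.sym (Equivalence.from (T≡span v) v∈span)) v∈T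
    ... | ()
    v∷b∈G : ∀ i → (v ∷ᶠ b) i ∈ˢ G
    v∷b∈G zero    = v∈G
    v∷b∈G (suc i) = T⊆G (basis-∈ T hT i)

  -- One coefficient vector per 1-dimensional subspace of K^d: its first nonzero entry is 1.
  normalised : ∀ d → List (Fin d → Carrier)
  normalised zero    = []
  normalised (suc d) = map (1# ∷ᶠ_) (allVecs d) ++ map (0# ∷ᶠ_) (normalised d)

  length-normalised : ∀ d → length (normalised d) ≡ gauss1 q d
  length-normalised zero    = refl
  length-normalised (suc d) = ≡.trans (length-++ (map (1# ∷ᶠ_) (allVecs d)))
    (≡.cong₂ _+_ (≡.trans (length-map _ (allVecs d)) (length-allVecs d))
                 (≡.trans (length-map _ (normalised d)) (length-normalised d)))

  normalised-nonzero : ∀ d → All (λ c → ¬ c ≋ (λ _ → 0#)) (normalised d)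
  normalised-nonzero zero    = []
  normalised-nonzero (suc d) = All.++⁺
    (All.map⁺ (All.universal (λ _ c≋0 → 0≉1 (≈-sym (c≋0 zero))) (allVecs d)))
    (All.map⁺ (All.map (λ c≉0 c≋0 → c≉0 (c≋0 ∘ suc)) (normalised-nonzero d)))

  normalise : ∀ {d} (c : Fin d → Carrier) → ¬ c ≋ (λ _ → 0#) →
    ∃[ a ] Any (_≋ (λ i → a · c i)) (normalised d)
  normalise {zero}  c c≉0 = ⊥-elim (c≉0 (λ ()))
  normalise {suc d} c c≉0 with c zero ≈? 0#
  ... | no c₀≉0 with inverse (c zero) c₀≉0
  ...   | y , c₀y≈1 = y , Any.++⁺ˡ (Any.map⁺ (Any.map scaled (allVecs-complete (λ i → y · c (suc i)))))
    where
    scaled : ∀ {v} → (λ i → y · c (suc i)) ≋ v → (1# ∷ᶠ v) ≋ (λ i → y · c i)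
    scaled _  zero    = ≈-sym (≈-trans (*-comm y (c zero)) c₀y≈1)
    scaled yc≋v (suc i) = ≈-sym (yc≋v i)
  normalise {suc d} c c≉0 | yes c₀≈0
    with normalise (c ∘ suc) (λ c₊≋0 → c≉0 λ { zero → c₀≈0 ; (suc i) → c₊≋0 i })
  ... | a , found = a , Any.++⁺ʳ (map (1# ∷ᶠ_) (allVecs d)) (Any.map⁺ (Any.map scaled found))
    where
    scaled : ∀ {v} → v ≋ (λ i → a · c (suc i)) → (0# ∷ᶠ v) ≋ (λ i → a · c i)
    scaled _  zero    = ≈-sym (≈-trans (*-congˡ c₀≈0) (zeroʳ a))
    scaled v≋ (suc i) = v≋ i

  adjoin : ∀ {s} → (Fin s → V) → V → Subspace
  adjoin b x = span (x ∷ᶠ b)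

  adjoin-dim : ∀ {s} (S : Subspace) ((b , _) : HasDim S s) {x} → ¬ x ∈ˢ S → HasDim (adjoin b x) (suc s)
  adjoin-dim S (b , ind , S≡span) {x} x∉S =
    span-dim {b = x ∷ᶠ b} (LinIndep-∷ ind (λ x∈span → x∉S (Equivalence.from (S≡span x) x∈span)))

  adjoin-⊆ : ∀ {s} (S G : Subspace) (hS@(b , _) : HasDim S s) {x} → S ⊆ˢ G → x ∈ˢ G → adjoin b x ⊆ˢ G
  adjoin-⊆ S G hS@(b , _) {x} S⊆G x∈G =
    span-⊆ {b = x ∷ᶠ b} G λ { zero → x∈G ; (suc i) → S⊆G (basis-∈ S hS i) }

  adjoin-point-dim : ∀ {s d} (S F : Subspace) (hS : HasDim S s) ((bF , _) : HasDim F d) → Disjoint S F →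
    ∀ {c} → c ∈ₚ normalised d → HasDim (adjoin (proj₁ hS) (lin c bF)) (suc s)
  adjoin-point-dim S F hS hF@(bF , indF , _) S∩F≡0 {c} c∈ = adjoin-dim S hS w∉S
    where
    w∉S : ¬ lin c bF ∈ˢ S
    w∉S w∈S = All.lookup (normalised-nonzero _) c∈
      (lin-injective indF (≋-trans (S∩F≡0 w∈S (lin-∈ F c (basis-∈ F hF))) (≋-sym (lin-zero bF))))

  meet⇒⊆-some-adjoin : ∀ {s d} (S F G : Subspace) (hS : HasDim S s) ((bF , _) : HasDim F d) → S ⊆ˢ G →
    ∃[ x ] (x ∈ˢ G × x ∈ˢ F × ¬ x ≋ 0ᵥ) →
    Any (λ c → adjoin (proj₁ hS) (lin c bF) ⊆ˢ G) (normalised d)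
  meet⇒⊆-some-adjoin S F G hS (bF , _ , F≡span) S⊆G (x , x∈G , x∈F , x≉0)
    with Equivalence.to (F≡span x) x∈F
  ... | c , x≋ with normalise c (λ c≋0 → x≉0 (≋-trans x≋ (≋-trans (lin-cong bF c≋0) (lin-zero bF))))
  ...   | a , found = Any.map (λ c'≋ac {_} → adjoin-⊆ S G hS S⊆G (scaled-x∈G c'≋ac)) found
    where
    scaled-x∈G : ∀ {c'} → c' ≋ (λ i → a · c i) → lin c' bF ∈ˢ G
    scaled-x∈G c'≋ac = ≡.trans
      (resp G (≋-trans (lin-cong bF c'≋ac) (≋-trans (lin-· a c bF) (λ j → *-congˡ (≈-sym (x≋ j))))))
      (closed-· G a x∈G)

  covers⊎misses : ∀ S 𝓕 → Covers S 𝓕 ⊎ Any (Disjoint S) 𝓕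
  covers⊎misses S []      = inj₁ (λ ())
  covers⊎misses S (G ∷ 𝓕) with Intersect⊎Disjoint S G | covers⊎misses S 𝓕
  ... | inj₂ S∩G≡0  | _              = inj₂ (here S∩G≡0)
  ... | inj₁ _      | inj₂ misses    = inj₂ (there misses)
  ... | inj₁ S∩G≢0 | inj₁ covers    = inj₁ λ { (here refl) → S∩G≢0 ; (there G'∈) → covers G'∈ }

  countSup≤sum : ∀ {X : Set} (S : Subspace) (T : X → Subspace) (xs : List X) (𝓕 : Family) →
    All (λ G → S ⊆ˢ G → Any (λ x → T x ⊆ˢ G) xs) 𝓕 →
    countSup S 𝓕 ≤ sum (map (λ x → countSup (T x) 𝓕) xs)
  countSup≤sum S T xs []      []                = z≤n
  countSup≤sum S T xs (G ∷ 𝓕) (G-covered ∷ rest) = begin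
    (if S ⊆ᵇ G then 1 else 0) + countSup S 𝓕
      ≤⟨ +-mono-≤ G-term≤ (countSup≤sum S T xs 𝓕 rest) ⟩
    sum (map (λ x → if T x ⊆ᵇ G then 1 else 0) xs) + sum (map (λ x → countSup (T x) 𝓕) xs)
      ≡⟨ sum-map-+ _ _ xs ⟨
    sum (map (λ x → countSup (T x) (G ∷ 𝓕)) xs) ∎
    where
    open ≤-Reasoning
    counted : ∀ P → P ⊆ˢ G → 1 ≤ (if P ⊆ᵇ G then 1 else 0)
    counted P P⊆G = ≤-reflexive (cong (λ b → if b then 1 else 0) (≡.sym (⊆ˢ⇒⊆ᵇ P G P⊆G)))
    G-term≤ : (if S ⊆ᵇ G then 1 else 0) ≤ sum (map (λ x → if T x ⊆ᵇ G then 1 else 0) xs)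
    G-term≤ with S ⊆ᵇ G in S⊆ᵇG
    ... | false = z≤n
    ... | true  = Any⇒≤sum _ (Any.map (λ {x} → counted (T x)) (G-covered (⊆ᵇ⇒⊆ˢ S G S⊆ᵇG)))

  countSup≡0 : ∀ T 𝓕 → All (λ G → T ⊆ᵇ G ≡ false) 𝓕 → countSup T 𝓕 ≡ 0
  countSup≡0 T []      []               = refl
  countSup≡0 T (G ∷ 𝓕) (T⊈G ∷ T⊈𝓕) rewrite T⊈G = countSup≡0 T 𝓕 T⊈𝓕

  countSup≤1 : ∀ {d} (T : Subspace) → HasDim T d → ∀ 𝓕 → IsFamily 𝓕 → AllDim 𝓕 d →
    countSup T 𝓕 ≤ 1
  countSup≤1 T hT []      _                _    = z≤n
  countSup≤1 T hT (G ∷ 𝓕) (G≠𝓕 ∷ distinct) dims with T ⊆ᵇ G in T⊆ᵇG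
  ... | false = countSup≤1 T hT 𝓕 distinct (dims ∘ there)
  ... | true  = ≤-reflexive (cong suc (countSup≡0 T 𝓕 (All.tabulate not-above)))
    where
    G⊆T : G ⊆ˢ T
    G⊆T = ⊆∧≡dim⇒⊇ T G hT (dims (here refl)) (⊆ᵇ⇒⊆ˢ T G T⊆ᵇG)
    not-above : ∀ {G'} → G' ∈ₚ 𝓕 → T ⊆ᵇ G' ≡ false
    not-above {G'} G'∈ with T ⊆ᵇ G' in T⊆ᵇG'
    ... | false = refl
    ... | true  = ⊥-elim (All.lookup G≠𝓕 G'∈
                    (⊆ˢ-antisym G G' (λ v∈G → T⊆G' (G⊆T v∈G)) (λ v∈G' → T⊆G (G'⊆T v∈G'))))
      where
      T⊆G : T ⊆ˢ G
      T⊆G = ⊆ᵇ⇒⊆ˢ T G T⊆ᵇG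
      T⊆G' : T ⊆ˢ G'
      T⊆G' = ⊆ᵇ⇒⊆ˢ T G' T⊆ᵇG'
      G'⊆T : G' ⊆ˢ T
      G'⊆T = ⊆∧≡dim⇒⊇ T G' hT (dims (there G'∈)) T⊆G'

  module Covering (m : ℕ) (𝓕 : Family) (distinct : IsFamily 𝓕) (dims : AllDim 𝓕 m)
                  (intersecting : IsIntersecting 𝓕) (τ≥m : ∀ T d → HasDim T d → Covers T 𝓕 → m ≤ d) where

    disjoint-member : ∀ {s} (S : Subspace) → HasDim S s → s < m → ∃[ F ] (F ∈ₚ 𝓕 × Disjoint S F)
    disjoint-member {s} S hS s<m with covers⊎misses S 𝓕
    ... | inj₁ covers = ⊥-elim (<⇒≱ s<m (τ≥m S s hS covers))
    ... | inj₂ misses = find misses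

    members-meet : ∀ {F G} → 0 < m → F ∈ₚ 𝓕 → G ∈ₚ 𝓕 → ∃[ x ] (x ∈ˢ G × x ∈ˢ F × ¬ x ≋ 0ᵥ)
    members-meet {F} {G} m>0 F∈ G∈ with allPairs-∈ intersecting G∈ F∈
    ... | inj₁ refl = let x , x∈F , x≉0 = nonzero-member F m>0 (dims F∈) in x , x∈F , x∈F , x≉0
    ... | inj₂ (inj₁ G∩F≢0) = Intersect⇒nonzero G F G∩F≢0
    ... | inj₂ (inj₂ F∩G≢0) = let x , x∈F , x∈G , x≉0 = Intersect⇒nonzero F G F∩G≢0 in x , x∈G , x∈F , x≉0

    climb-one : ∀ {s} (S : Subspace) → HasDim S s → s < m →
      ∃[ P ] (HasDim P (suc s) × countSup S 𝓕 ≤ gauss1 q m * countSup P 𝓕)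
    climb-one {s} S hS s<m with disjoint-member S hS s<m
    ... | F , F∈ , S∩F≡0 = best-point (∃-≥-mean count (normalised m) points>0)
      where
      open ≤-Reasoning
      m>0 : 0 < m
      m>0 = ≤-trans (s≤s z≤n) s<m
      T : (Fin m → Carrier) → Subspace
      T c = adjoin (proj₁ hS) (lin c (proj₁ (dims F∈)))
      count : (Fin m → Carrier) → ℕ
      count c = countSup (T c) 𝓕
      points>0 : 0 < length (normalised m)
      points>0 = subst (0 <_) (≡.sym (length-normalised m)) (gauss1-pos m (≤-trans (s≤s z≤n) 2≤q) m>0)
      covered : All (λ G → S ⊆ˢ G → Any (λ c → T c ⊆ˢ G) (normalised m)) 𝓕
      covered = All.tabulate λ {G} G∈ S⊆G →
        meet⇒⊆-some-adjoin S F G hS (dims F∈) S⊆G (members-meet m>0 F∈ G∈)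
      best-point : ∃[ c ] (c ∈ₚ normalised m × sum (map count (normalised m)) ≤ length (normalised m) * count c) →
                   ∃[ P ] (HasDim P (suc s) × countSup S 𝓕 ≤ gauss1 q m * countSup P 𝓕)
      best-point (c , c∈ , mean≤) = T c , adjoin-point-dim S F hS (dims F∈) S∩F≡0 c∈ , (begin
        countSup S 𝓕                        ≤⟨ countSup≤sum S T (normalised m) 𝓕 covered ⟩
        sum (map count (normalised m))      ≤⟨ mean≤ ⟩
        length (normalised m) * count c     ≡⟨ cong (_* count c) (length-normalised m) ⟩
        gauss1 q m * count c                ∎)

    climb : ∀ r {s} (S : Subspace) → HasDim S s → r + s ≤ m →
      ∃[ T ] (HasDim T (r + s) × countSup S 𝓕 ≤ gauss1 q m ^ r * countSup T 𝓕)
    climb zero    S hS _ = S , hS , ≤-reflexive (≡.sym (ℕ.*-identityˡ _))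
    climb (suc r) {s} S hS r+s<m with climb-one S hS (≤-trans (s≤s (m≤n+m s r)) r+s<m)
    ... | P , hP , S≤gP with climb r P hP (subst (_≤ m) (≡.sym (+-suc r s)) r+s<m)
    ...   | T , hT , P≤grT = T , subst (HasDim T) (+-suc r s) hT , (begin
      countSup S 𝓕                    ≤⟨ S≤gP ⟩
      g * countSup P 𝓕                ≤⟨ *-monoʳ-≤ g P≤grT ⟩
      g * (g ^ r * countSup T 𝓕)      ≡⟨ ℕ.*-assoc g (g ^ r) _ ⟨
      g ^ suc r * countSup T 𝓕        ∎)
      where
      open ≤-Reasoning
      g : ℕ
      g = gauss1 q m

    countSup-climb : (s t : ℕ) → s ≤ t → t ≤ m → (S : Subspace) → HasDim S s →
      ∃[ T ] (HasDim T t × countSup S 𝓕 ≤ gauss1 q m ^ (t ∸ s) * countSup T 𝓕)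
    countSup-climb s t s≤t t≤m S hS with climb (t ∸ s) S hS (subst (_≤ m) (≡.sym (m∸n+n≡m s≤t)) t≤m)
    ... | T , hT , bound = T , subst (HasDim T) (m∸n+n≡m s≤t) hT , bound

    countSup≤gauss1^ : (s : ℕ) → s ≤ m → (S : Subspace) → HasDim S s → countSup S 𝓕 ≤ gauss1 q m ^ (m ∸ s)
    countSup≤gauss1^ s s≤m S hS with countSup-climb s m s≤m ≤-refl S hS
    ... | T , hT , bound = ≤-trans bound
            (≤-trans (*-monoʳ-≤ (gauss1 q m ^ (m ∸ s)) (countSup≤1 T hT 𝓕 distinct dims))
                     (≤-reflexive (ℕ.*-identityʳ _)))

corollary2p2 : (q : ℕ) → IsPrimePower q → (K : FiniteField q) → (m n : ℕ) → 3 ≤ m →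
    let open VectorSpace K n in
    (𝓕 : Family) → IsFamily 𝓕 → AllDim 𝓕 m → IsIntersecting 𝓕 → CoveringNumber 𝓕 m →
    ((s t : ℕ) → s ≤ t → t ≤ m → (S : Subspace) → HasDim S s →
      ∃[ T ] (HasDim T t × countSup S 𝓕 ≤ gauss1 q m ^ (t ∸ s) * countSup T 𝓕))
    × ((s : ℕ) → s ≤ m → (S : Subspace) → HasDim S s → countSup S 𝓕 ≤ gauss1 q m ^ (m ∸ s))
corollary2p2 q _ K m n _ 𝓕 distinct dims intersecting (_ , τ-minimal) = countSup-climb , countSup≤gauss1^
  where open LinearAlgebra.Covering K n m 𝓕 distinct dims intersecting τ-minimal
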